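{- Let $\mathcal F=(F,\mathcal B(F),\overline{\prec})$ be the measurable labelled transition system defined below. The relation of bisimilarity on $\mathcal F$ is a $\boldsymbol\Sigma^1_1$ (analytic) subset of $F\times F$.
   Context: $\mathbb N^*$ denotes the set of finite sequences of natural numbers with the discrete topology; $s\prec s'$ means $s'=s^\frown n$ for some $n\in\mathbb N$. A tree on $\mathbb N$ is a prefix-closed subset of $\mathbb N^*$; $\mathrm{Tr}_{\mathbb N}$ is the set of all trees, a closed subspace of $2^{\mathbb N^*}$ (product topology). Let $F=\mathrm{Tr}_{\mathbb N}\times\mathbb N^*$ with the product topology (a Polish space). There is a single label, and the transition relation is $(T,s)\,\overline{\prec}\,(T',s')$ iff $T=T'$, $s,s'\in T$ and $s\prec s'$. Bisimilarity on $\mathcal F$ is standard (Milner) bisimilarity of this labelled transition system. -}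

module Defs where

open import Data.Nat using (ℕ; _≤_; _<_)
open import Data.Bool using (Bool; true)
open import Data.List using (List; length; _∷ʳ_)
open import Data.List.Relation.Unary.All using (All)
open import Data.Product using (Σ; ∃; _×_; _,_)
open import Level using (Level; suc; _⊔_) renaming (zero to 0ℓ)
open import Relation.Binary.PropositionalEquality using (_≡_)

Seq : Set
Seq = List ℕ

_≺_ : Seq → Seq → Set
s ≺ s' = ∃ λ n → s' ≡ s ∷ʳ n

Subsets : Set
Subsets = Seq → Bool

_∈T_ : Seq → Subsets → Set
s ∈T T = T s ≡ true

-- a tree: prefix-closed subset of ℕ* (closure under one-step prefixes
-- is equivalent to closure under all prefixes)
IsTree : Subsets → Set
IsTree T = ∀ s s' → s ≺ s' → s' ∈T T → s ∈T T

Tr : Set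
Tr = Σ Subsets IsTree

F : Set
F = Tr × Seq

tree : F → Subsets
tree ((T , _) , _) = T

node : F → Seq
node (_ , s) = s

_⇝_ : F → F → Set
x ⇝ y = (∀ u → tree x u ≡ tree y u) × (node x ∈T tree x) × (node y ∈T tree x) × (node x ≺ node y)

IsBisimulation : (F → F → Set) → Set
IsBisimulation R = ∀ x y → R x y →
  ((∀ x' → x ⇝ x' → ∃ λ y' → (y ⇝ y') × R x' y') ×
   (∀ y' → y ⇝ y' → ∃ λ x' → (x ⇝ x') × R x' y'))

Bisimilar : F → F → Set₁
Bisimilar x y = ∃ λ (R : F → F → Set) → IsBisimulation R × R x y

-- Topology of F × F × ℕ^ℕ via the standard basic neighbourhoods.

Bounded : ℕ → Seq → Set
Bounded n s = (length s ≤ n) × All (_< n) s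

AgreeSub : ℕ → Subsets → Subsets → Set
AgreeSub n T T' = ∀ s → Bounded n s → T s ≡ T' s

AgreeF : ℕ → F → F → Set
AgreeF n x y = AgreeSub n (tree x) (tree y) × (node x ≡ node y)

Baire : Set
Baire = ℕ → ℕ

AgreeBaire : ℕ → Baire → Baire → Set
AgreeBaire n α β = ∀ i → i < n → α i ≡ β i

IsClosed : (F → F → Baire → Set) → Set
IsClosed C = ∀ x y α →
  (∀ n → ∃ λ x' → ∃ λ y' → ∃ λ α' →
      AgreeF n x x' × AgreeF n y y' × AgreeBaire n α α' × C x' y' α') →
  C x y α

IsAnalytic : ∀ {ℓ} → (F → F → Set ℓ) → Set (suc 0ℓ ⊔ ℓ)
IsAnalytic A = ∃ λ (C : F → F → Baire → Set) → IsClosed C ×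
  (∀ x y → (A x y → ∃ λ α → C x y α) × ((∃ λ α → C x y α) → A x y))

module Submission where

-- Two points x, y are bisimilar iff the duplicator has a winning strategy in
-- the bisimulation game: the spoiler repeatedly extends the current node on
-- one side by a child n (legally, i.e. inside the tree), and the duplicator
-- must answer by a legal child k on the other side.  Coding finite histories
-- of spoiler moves by natural numbers, a duplicator strategy is a point
-- α ∈ ℕ^ℕ, and "α is winning" is a condition Winning x y α.  Then
--   * Winning is closed: each instance of the winning condition only
--     inspects finitely many coordinates of x, y and α (closedness section);
--   * a winning strategy yields a bisimulation, namely the set of pairs of
--     positions reached along legal plays (soundness);
--   * a bisimulation yields a winning strategy, by letting the duplicator
--     answer with the moves the bisimulation provides (completeness).
-- Hence bisimilarity is the projection of the closed set Winning along ℕ^ℕ.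

open import Defs
open import Data.Nat using (ℕ; zero; suc; _+_; _≤_; _<_; s≤s; z≤n)
open import Data.Nat.Properties using (≤-refl; ≤-trans; ≤-reflexive; m≤m+n; m≤n+m; +-identityʳ; +-suc)
open import Data.Nat.ListAction using (sum)
open import Data.Bool using (true)
open import Data.Bool.Properties using (_≟_)
open import Data.List using (List; []; _∷_; length; _∷ʳ_)
open import Data.List.Properties using (length-++)
open import Data.List.Relation.Unary.All using (All; []; _∷_)
open import Data.List.Relation.Unary.All.Properties using (++⁻ˡ)
open import Data.Product using (Σ; ∃; _×_; _,_; proj₁; proj₂)
open import Data.Unit using (⊤; tt)
open import Function using (flip)
open import Relation.Nullary using (Dec; yes; no; contradiction)
open import Relation.Nullary.Decidable using (_×-dec_)
open import Relation.Binary.PropositionalEquality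

record Coding (A : Set) : Set where
  field
    encode        : A → ℕ
    decode        : ℕ → A
    decode-encode : ∀ a → decode (encode a) ≡ a

open Coding

-- Cantor pairing, enumerating ℕ × ℕ diagonal by diagonal:
-- triangle d counts the pairs on the diagonals before diagonal d.
triangle : ℕ → ℕ
triangle zero    = zero
triangle (suc d) = triangle d + suc d

pair : ℕ → ℕ → ℕ
pair a b = triangle (a + b) + b

next : ℕ × ℕ → ℕ × ℕ
next (zero  , b) = suc b , zero
next (suc a , b) = a , suc b

walk : ℕ → ℕ × ℕ → ℕ × ℕ
walk zero    p = p
walk (suc k) p = walk k (next p)

unpair : ℕ → ℕ × ℕ
unpair k = walk k (0 , 0)

walk-+ : ∀ m n p → walk (m + n) p ≡ walk n (walk m p)
walk-+ zero    n p = refl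
walk-+ (suc m) n p = walk-+ m n (next p)

walk-suc : ∀ k p → walk (suc k) p ≡ next (walk k p)
walk-suc zero    p = refl
walk-suc (suc k) p = walk-suc k (next p)

walk-diagonal : ∀ a b c → walk b (a + b , c) ≡ (a , b + c)
walk-diagonal a zero    c rewrite +-identityʳ a = refl
walk-diagonal a (suc b) c rewrite +-suc a b =
  trans (walk-diagonal a b (suc c)) (cong (a ,_) (+-suc b c))

walk-triangle : ∀ d → walk (triangle d) (0 , 0) ≡ (d , 0)
walk-triangle zero    = refl
walk-triangle (suc d) = begin
  walk (triangle d + suc d) (0 , 0)        ≡⟨ walk-+ (triangle d) (suc d) (0 , 0) ⟩
  walk (suc d) (walk (triangle d) (0 , 0)) ≡⟨ cong (walk (suc d)) (walk-triangle d) ⟩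
  walk (suc d) (d , 0)                     ≡⟨ walk-suc d (d , 0) ⟩
  next (walk d (d , 0))                    ≡⟨ cong next (walk-diagonal 0 d 0) ⟩
  next (0 , d + 0)                         ≡⟨ cong (λ e → suc e , 0) (+-identityʳ d) ⟩
  (suc d , 0)                              ∎
  where open ≡-Reasoning

unpair-pair : ∀ a b → unpair (pair a b) ≡ (a , b)
unpair-pair a b = begin
  walk (triangle (a + b) + b) (0 , 0)        ≡⟨ walk-+ (triangle (a + b)) b (0 , 0) ⟩
  walk b (walk (triangle (a + b)) (0 , 0))   ≡⟨ cong (walk b) (walk-triangle (a + b)) ⟩
  walk b (a + b , 0)                         ≡⟨ walk-diagonal a b 0 ⟩
  (a , b + 0)                                ≡⟨ cong (a ,_) (+-identityʳ b) ⟩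
  (a , b)                                    ∎
  where open ≡-Reasoning

ℕ-coding : Coding ℕ
encode        ℕ-coding n = n
decode        ℕ-coding n = n
decode-encode ℕ-coding n = refl

×-coding : {A B : Set} → Coding A → Coding B → Coding (A × B)
encode        (×-coding CA CB) (a , b) = pair (encode CA a) (encode CB b)
decode        (×-coding CA CB) k       = decode CA (proj₁ (unpair k)) , decode CB (proj₂ (unpair k))
decode-encode (×-coding CA CB) (a , b)
  rewrite unpair-pair (encode CA a) (encode CB b) =
  cong₂ _,_ (decode-encode CA a) (decode-encode CB b)

module ListCoding {A : Set} (CA : Coding A) where

  encodeList : List A → ℕ
  encodeList []       = 0
  encodeList (a ∷ as) = suc (pair (encode CA a) (encodeList as))

  decodeList : ℕ → ℕ → List A
  decodeList zero    _       = []
  decodeList (suc f) zero    = []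
  decodeList (suc f) (suc k) =
    decode CA (proj₁ (unpair k)) ∷ decodeList f (proj₂ (unpair k))

  decodeList-encodeList : ∀ f as → length as ≤ f → decodeList f (encodeList as) ≡ as
  decodeList-encodeList zero    []       _         = refl
  decodeList-encodeList (suc f) []       _         = refl
  decodeList-encodeList (suc f) (a ∷ as) (s≤s len)
    rewrite unpair-pair (encode CA a) (encodeList as) =
    cong₂ _∷_ (decode-encode CA a) (decodeList-encodeList f as len)

  -- The code of a list exceeds its length, so it is enough fuel.
  length≤encodeList : ∀ as → length as ≤ encodeList as
  length≤encodeList []       = z≤n
  length≤encodeList (a ∷ as) =
    s≤s (≤-trans (length≤encodeList as) (m≤n+m _ (triangle (encode CA a + encodeList as))))

  coding : Coding (List A)
  encode        coding    = encodeList
  decode        coding k  = decodeList k k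
  decode-encode coding as = decodeList-encodeList (encodeList as) as (length≤encodeList as)

-- The two sides of the game; a spoiler move is a side and a child index.
data Side : Set where
  left right : Side

opp : Side → Side
opp left  = right
opp right = left

sel : {A : Set} → Side → A × A → A
sel left  = proj₁
sel right = proj₂

side-coding : Coding Side
encode        side-coding left    = 0
encode        side-coding right   = 1
decode        side-coding zero    = left
decode        side-coding (suc _) = right
decode-encode side-coding left    = refl
decode-encode side-coding right   = refl

Challenge : Set
Challenge = Side × ℕ

-- Histories of spoiler moves, most recent first.
History : Set
History = List Challenge

-- Strategies are indexed by codes of histories.
history-coding : Coding History
history-coding = ListCoding.coding (×-coding side-coding ℕ-coding)

⌜_⌝ : History → ℕ
⌜ h ⌝ = encode history-coding h

Step : Subsets → Seq → ℕ → Set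
Step T u n = u ∈T T × (u ∷ʳ n) ∈T T

-- Legality is decidable, so the duplicator can test it.
step? : ∀ T u n → Dec (Step T u n)
step? T u n = (T u ≟ true) ×-dec (T (u ∷ʳ n) ≟ true)

extend : Side → ℕ → ℕ → Seq × Seq → Seq × Seq
extend left  n k p = proj₁ p ∷ʳ n , proj₂ p ∷ʳ k
extend right n k p = proj₁ p ∷ʳ k , proj₂ p ∷ʳ n

-- The pair of nodes reached from s after the history h, when the
-- duplicator answers the history h by the child α ⌜ h ⌝.
pos : Baire → Seq × Seq → History → Seq × Seq
pos α s []            = s
pos α s ((σ , n) ∷ h) = extend σ n (α ⌜ (σ , n) ∷ h ⌝) (pos α s h)

Legal : Baire → Subsets × Subsets → Seq × Seq → History → Set
Legal α Ts s []            = ⊤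
Legal α Ts s ((σ , n) ∷ h) = Legal α Ts s h × Step (sel σ Ts) (sel σ (pos α s h)) n

Wins : Baire → Subsets × Subsets → Seq × Seq → Set
Wins α Ts s = ∀ h → Legal α Ts s h → ∀ σ n →
  Step (sel σ Ts) (sel σ (pos α s h)) n →
  Step (sel (opp σ) Ts) (sel (opp σ) (pos α s h)) (α ⌜ (σ , n) ∷ h ⌝)

Winning : F → F → Baire → Set
Winning x y α = Wins α (tree x , tree y) (node x , node y)

-- Closedness: the winning condition has finite character

-- A level at which w is a bounded sequence (bounded-by-size).
size : Seq → ℕ
size w = length w + suc (sum w)

entries< : ∀ {M} w → suc (sum w) ≤ M → All (_< M) w
entries< []       _  = []
entries< (x ∷ xs) le =
  ≤-trans (s≤s (m≤m+n x (sum xs))) le ∷ entries< xs (≤-trans (s≤s (m≤n+m (sum xs) x)) le)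

bounded-by-size : ∀ {N} w → size w ≤ N → Bounded N w
bounded-by-size w le = ≤-trans (m≤m+n _ _) le , entries< w (≤-trans (m≤n+m _ (length w)) le)

bounded-parent : ∀ {N} u n → Bounded N (u ∷ʳ n) → Bounded N u
bounded-parent u n (len , entries) =
  ≤-trans (≤-trans (m≤m+n (length u) 1) (≤-reflexive (sym (length-++ u)))) len , ++⁻ˡ u entries

-- A level beyond which α and the trees are not inspected along h:
-- it exceeds the codes of all nonempty prefixes of h and the sizes of
-- all positions reached along h.
bound : Baire → Seq × Seq → History → ℕ
bound α s []      = 0
bound α s (c ∷ h) =
  bound α s h + (suc ⌜ c ∷ h ⌝ + (size (proj₁ (pos α s (c ∷ h))) + size (proj₂ (pos α s (c ∷ h)))))

module _ (α : Baire) (s : Seq × Seq) (c : Challenge) (h : History) where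

  bound-tail : bound α s h ≤ bound α s (c ∷ h)
  bound-tail = m≤m+n _ _

  bound-code : ⌜ c ∷ h ⌝ < bound α s (c ∷ h)
  bound-code = ≤-trans (m≤m+n (suc ⌜ c ∷ h ⌝) _) (m≤n+m _ (bound α s h))

  node-bounded : ∀ {N} τ → bound α s (c ∷ h) ≤ N → Bounded N (sel τ (pos α s (c ∷ h)))
  node-bounded τ le =
    bounded-by-size _ (≤-trans (size≤ τ) (≤-trans (m≤n+m _ (suc ⌜ c ∷ h ⌝)) (≤-trans (m≤n+m _ (bound α s h)) le)))
    where
    p = pos α s (c ∷ h)
    size≤ : ∀ τ → size (sel τ p) ≤ size (proj₁ p) + size (proj₂ p)
    size≤ left  = m≤m+n (size (proj₁ p)) (size (proj₂ p))
    size≤ right = m≤n+m (size (proj₂ p)) (size (proj₁ p))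

challenge-bounded : ∀ {N} α s σ n h → bound α s ((σ , n) ∷ h) ≤ N →
  Bounded N (sel σ (pos α s h) ∷ʳ n)
challenge-bounded α s left  n h = node-bounded α s (left , n) h left
challenge-bounded α s right n h = node-bounded α s (right , n) h right

answer-bounded : ∀ {N} α s σ n h → bound α s ((σ , n) ∷ h) ≤ N →
  Bounded N (sel (opp σ) (pos α s h) ∷ʳ α ⌜ (σ , n) ∷ h ⌝)
answer-bounded α s left  n h = node-bounded α s (left , n) h right
answer-bounded α s right n h = node-bounded α s (right , n) h left

pos-agree : ∀ {N α α'} s h → AgreeBaire N α α' → bound α s h ≤ N → pos α s h ≡ pos α' s h
pos-agree         s []            aα le = refl
pos-agree {α = α} s ((σ , n) ∷ h) aα le =
  cong₂ (extend σ n) (aα _ (≤-trans (bound-code α s (σ , n) h) le))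
                     (pos-agree s h aα (≤-trans (bound-tail α s (σ , n) h) le))

step-agree : ∀ {N T T' u n} → AgreeSub N T T' → Bounded N (u ∷ʳ n) → Step T u n → Step T' u n
step-agree {u = u} {n} ag b (inu , inun) =
  trans (sym (ag u (bounded-parent u n b))) inu , trans (sym (ag (u ∷ʳ n) b)) inun

AgreePair : ℕ → Subsets × Subsets → Subsets × Subsets → Set
AgreePair N Ts Ts' = ∀ τ → AgreeSub N (sel τ Ts) (sel τ Ts')

legal-agree : ∀ {N α α' Ts Ts'} s h → AgreePair N Ts Ts' → AgreeBaire N α α' →
  bound α s h ≤ N → Legal α Ts s h → Legal α' Ts' s h
legal-agree s []            ag aα le tt = tt
legal-agree {α = α} {Ts' = Ts'} s ((σ , n) ∷ h) ag aα le (legal , st) =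
  legal-agree s h ag aα le-h legal ,
  subst (λ p → Step (sel σ Ts') (sel σ p) n) (pos-agree s h aα le-h)
        (step-agree (ag σ) (challenge-bounded α s σ n h le) st)
  where le-h = ≤-trans (bound-tail α s (σ , n) h) le

wins-closed : ∀ {α Ts s} →
  (∀ N → ∃ λ Ts' → ∃ λ α' → AgreePair N Ts Ts' × AgreeBaire N α α' × Wins α' Ts' s) →
  Wins α Ts s
wins-closed {α} {s = s} approx h legal σ n st with approx (bound α s ((σ , n) ∷ h))
... | Ts' , α' , ag , aα , wins' =
  step-agree (λ w b → sym (ag (opp σ) w b)) (answer-bounded α s σ n h ≤-refl) answer'
  where
  same-pos : pos α s h ≡ pos α' s h
  same-pos = pos-agree s h aα (bound-tail α s (σ , n) h)

  same-answer : α ⌜ (σ , n) ∷ h ⌝ ≡ α' ⌜ (σ , n) ∷ h ⌝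
  same-answer = aα _ (bound-code α s (σ , n) h)

  challenge' : Step (sel σ Ts') (sel σ (pos α' s h)) n
  challenge' = subst (λ p → Step (sel σ Ts') (sel σ p) n) same-pos
                     (step-agree (ag σ) (challenge-bounded α s σ n h ≤-refl) st)

  answer' : Step (sel (opp σ) Ts') (sel (opp σ) (pos α s h)) (α ⌜ (σ , n) ∷ h ⌝)
  answer' = subst₂ (λ p k → Step (sel (opp σ) Ts') (sel (opp σ) p) k) (sym same-pos) (sym same-answer)
                   (wins' h (legal-agree s h ag aα (bound-tail α s (σ , n) h) legal) σ n challenge')

-- a is the point (T , u) up to pointwise equality of trees.
record At (T : Subsets) (u : Seq) (a : F) : Set where
  constructor at
  field
    same-tree : tree a ≗ T
    same-node : node a ≡ u

At-self : ∀ a → At (tree a) (node a) a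
At-self a = at (λ _ → refl) refl

At-compose : ∀ {T u a n z} → At T u a → At (tree a) (node a ∷ʳ n) z → At T (u ∷ʳ n) z
At-compose {n = n} (at ta na) (at tz nz) = at (λ w → trans (tz w) (ta w)) (trans nz (cong (_∷ʳ n) na))

At-transition : ∀ {T u a z} → At T u a → a ⇝ z → ∃ λ n → Step T u n × At T (u ∷ʳ n) z
At-transition {T} {a = a} (at ta na) (tz , ina , inz , n , zn) =
  n , (member na ina , member nz inz) , at (λ w → trans (sym (tz w)) (ta w)) nz
  where
  nz = trans zn (cong (_∷ʳ n) na)
  member : ∀ {v w} → v ≡ w → tree a v ≡ true → T w ≡ true
  member refl inv = trans (sym (ta _)) inv

At-step : ∀ {T u a k} → At T u a → Step T u k → Σ F λ z → (a ⇝ z) × At T (u ∷ʳ k) z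
At-step {u = u} {a} {k} (at ta refl) (inu , inuk) =
  (proj₁ a , u ∷ʳ k) ,
  ((λ _ → refl) , trans (ta u) inu , trans (ta (u ∷ʳ k)) inuk , k , refl) ,
  at ta refl

At-child : ∀ {T v k k' z} → k ≡ k' → At T (v ∷ʳ k) z → At T (v ∷ʳ k') z
At-child refl a = a

step-At : ∀ {T u a n} → At T u a → Step T u n → Step (tree a) (node a) n
step-At (at ta refl) (inu , inun) = trans (ta _) inu , trans (ta _) inun

module Soundness (x y : F) (α : Baire) (wins : Winning x y α) where

  Ts : Subsets × Subsets
  Ts = tree x , tree y

  s : Seq × Seq
  s = node x , node y

  Reached : F → F → Set
  Reached a b = Σ History λ h → Legal α Ts s h ×
    At (tree x) (proj₁ (pos α s h)) a × At (tree y) (proj₂ (pos α s h)) b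

  reached-bisimulation : IsBisimulation Reached
  reached-bisimulation a b (h , legal , ata , atb) = forth , back
    where
    forth : ∀ a' → a ⇝ a' → ∃ λ b' → (b ⇝ b') × Reached a' b'
    forth a' tr =
      let (n , st , ata') = At-transition ata tr
          (b' , tr' , atb') = At-step atb (wins h legal left n st)
      in b' , tr' , (left , n) ∷ h , (legal , st) , ata' , atb'

    back : ∀ b' → b ⇝ b' → ∃ λ a' → (a ⇝ a') × Reached a' b'
    back b' tr =
      let (n , st , atb') = At-transition atb tr
          (a' , tr' , ata') = At-step ata (wins h legal right n st)
      in a' , tr' , (right , n) ∷ h , (legal , st) , ata' , atb'

  bisimilar : Bisimilar x y
  bisimilar = Reached , reached-bisimulation , [] , tt , At-self x , At-self y

Related : (F → F → Set) → Set
Related R = Σ F λ a → Σ F λ b → R a b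

swap : ∀ {R} → Related R → Related (flip R)
swap (a , b , r) = b , a , r

converse : ∀ {R} → IsBisimulation R → IsBisimulation (flip R)
converse bis b a r = proj₂ (bis a b r) , proj₁ (bis a b r)

respond : ∀ {R} → IsBisimulation R → Related R → ℕ → Related R × ℕ
respond bis (a , b , r) n with step? (tree a) (node a) n
... | no _   = (a , b , r) , 0
... | yes st =
  let (a' , tr , _) = At-step (At-self a) st
      (b' , tr' , r') = proj₁ (bis a b r) a' tr
  in (a' , b' , r') , proj₁ (At-transition {z = b'} (At-self b) tr')

point : ∀ {R} → Side → Related R → F
point left  p = proj₁ p
point right p = proj₁ (proj₂ p)

Answers : ∀ {R} → Side → Subsets → Seq → Subsets → Seq → ℕ → Related R × ℕ → Set
Answers σ T u T' v n (q , k) = At T (u ∷ʳ n) (point σ q) × Step T' v k × At T' (v ∷ʳ k) (point (opp σ) q)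

respond-answers : ∀ {R T u T' v n} (bis : IsBisimulation R) (p : Related R) →
  At T u (proj₁ p) → At T' v (proj₁ (proj₂ p)) → Step T u n →
  Answers left T u T' v n (respond bis p n)
respond-answers {n = n} bis (a , b , r) ata atb st with step? (tree a) (node a) n
... | no ¬st  = contradiction (step-At ata st) ¬st
... | yes st' =
  let (a' , tr , ata') = At-step (At-self a) st'
      (b' , tr' , _) = proj₁ (bis a b r) a' tr
      (_ , st-b , atb') = At-transition atb tr'
  in At-compose ata ata' , st-b , atb'

module Completeness (x y : F) (R : F → F → Set) (bis : IsBisimulation R) (r₀ : R x y) where

  Ts : Subsets × Subsets
  Ts = tree x , tree y

  s : Seq × Seq
  s = node x , node y

  -- Right moves are answered through the converse bisimulation.
  turn : Side → Related R → ℕ → Related R × ℕ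
  turn left  p n = respond bis p n
  turn right p n = let (q , k) = respond (converse bis) (swap p) n in swap q , k

  play : History → Related R × ℕ
  play []            = (x , y , r₀) , 0
  play ((σ , n) ∷ h) = turn σ (proj₁ (play h)) n

  strategy : Baire
  strategy k = proj₂ (play (decode history-coding k))

  strategy-code : ∀ h → strategy ⌜ h ⌝ ≡ proj₂ (play h)
  strategy-code h = cong (λ h → proj₂ (play h)) (decode-encode history-coding h)

  Tracks : History → Set
  Tracks h = At (tree x) (proj₁ (pos strategy s h)) (proj₁ (proj₁ (play h))) ×
             At (tree y) (proj₂ (pos strategy s h)) (proj₁ (proj₂ (proj₁ (play h))))

  answers : ∀ h σ n → Tracks h → Step (sel σ Ts) (sel σ (pos strategy s h)) n →
    Answers σ (sel σ Ts) (sel σ (pos strategy s h)) (sel (opp σ) Ts) (sel (opp σ) (pos strategy s h))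
            n (turn σ (proj₁ (play h)) n)
  answers h left  n (ata , atb) st = respond-answers bis (proj₁ (play h)) ata atb st
  answers h right n (ata , atb) st = respond-answers (converse bis) (swap (proj₁ (play h))) atb ata st

  tracks : ∀ h → Legal strategy Ts s h → Tracks h
  tracks []                 _            = At-self x , At-self y
  tracks ((left , n) ∷ h)   (legal , st) =
    let (ata' , _ , atb') = answers h left n (tracks h legal) st
    in ata' , At-child (sym (strategy-code ((left , n) ∷ h))) atb'
  tracks ((right , n) ∷ h)  (legal , st) =
    let (atb' , _ , ata') = answers h right n (tracks h legal) st
    in At-child (sym (strategy-code ((right , n) ∷ h))) ata' , atb'

  winning : Winning x y strategy
  winning h legal σ n st =
    subst (Step (sel (opp σ) Ts) (sel (opp σ) (pos strategy s h))) (sym (strategy-code ((σ , n) ∷ h)))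
          (proj₁ (proj₂ (answers h σ n (tracks h legal) st)))

-- Approximating (x , y , α) within the basic neighbourhoods of F × F × ℕ^ℕ
-- approximates the game trees and the strategy, so wins-closed applies.
winning-closed : IsClosed Winning
winning-closed x y α approx = wins-closed λ N →
  let (x' , y' , α' , (ax , ex) , (ay , ey) , aα , w) = approx N
      ag : AgreePair N (tree x , tree y) (tree x' , tree y')
      ag = λ { left → ax ; right → ay }
  in (tree x' , tree y') , α' , ag , aα ,
     subst₂ (λ u v → Wins α' (tree x' , tree y') (u , v)) (sym ex) (sym ey) w

mainTheorem4 : IsAnalytic Bisimilar
mainTheorem4 = Winning , winning-closed , λ x y →
  (λ { (R , bis , r) → Completeness.strategy x y R bis r , Completeness.winning x y R bis r }) ,
  (λ { (α , w) → Soundness.bisimilar x y α w })
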